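{- For $m,n\geq 0$, the order dimension of $\mathbf{Bub}(m,n)$ is at least $m+n$.
   Context: Disjoint alphabets $X=\{x_1,\dots,x_m\}$, $Y=\{y_1,\dots,y_n\}$. A word is simple if it has no repeated letter. $\mathsf{Shuf}(m,n)$ is the set of simple words over $X\cup Y$ in which the letters of $X$ appear in increasing order of index and those of $Y$ in increasing order of index. For $\mathbf{u}=u_1\cdots u_k$, $\mathbf{u}_{\hat\imath}$ is $\mathbf{u}$ with $u_i$ deleted. Indels: $\mathbf{u}\to\mathbf{u}_{\hat\imath}$ if $u_i\in X$, and $\mathbf{u}_{\hat\imath}\to\mathbf{u}$ if $u_i\in Y$. Transpositions: $\mathbf{u}\Rightarrow\mathbf{u}'$ where $u_i\in X$, $u_{i+1}\in Y$ and $\mathbf{u}'$ is $\mathbf{u}$ with $u_i,u_{i+1}$ swapped. The bubble order $\leq_{\mathsf{bub}}$ is the reflexive transitive closure of indels and transpositions; $\mathbf{Bub}(m,n)=(\mathsf{Shuf}(m,n),\leq_{\mathsf{bub}})$. The order dimension of a finite poset is the least $d$ such that its order relation is the intersection of $d$ linear extensions. -}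

module Defs where

open import Data.Nat using (ℕ)
open import Data.Fin using (Fin) renaming (_<_ to _<ᶠ_)
open import Data.Sum using (_⊎_; inj₁; inj₂)
open import Data.Maybe using (Maybe; just; nothing)
open import Data.List using (List; []; _∷_; _++_; mapMaybe)
open import Data.List.Relation.Unary.Linked using (Linked)
open import Data.List.Relation.Unary.Unique.Propositional using (Unique)
open import Data.Product using (_×_)
open import Relation.Binary.PropositionalEquality using (_≡_)
open import Relation.Binary.Construct.Closure.ReflexiveTransitive using (Star)
open import Function.Bundles using (_⇔_)

-- Letters over X ∪ Y: inj₁ i is x_{i+1} ∈ X, inj₂ j is y_{j+1} ∈ Y.
Letter : ℕ → ℕ → Set
Letter m n = Fin m ⊎ Fin n

Word : ℕ → ℕ → Set
Word m n = List (Letter m n)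

module _ {m n : ℕ} where

  getX : Letter m n → Maybe (Fin m)
  getX (inj₁ i) = just i
  getX (inj₂ _) = nothing

  getY : Letter m n → Maybe (Fin n)
  getY (inj₁ _) = nothing
  getY (inj₂ j) = just j

  xLetters : Word m n → List (Fin m)
  xLetters = mapMaybe getX

  yLetters : Word m n → List (Fin n)
  yLetters = mapMaybe getY

  IsShuf : Word m n → Set
  IsShuf u = Unique u × Linked _<ᶠ_ (xLetters u) × Linked _<ᶠ_ (yLetters u)

  data Step : Word m n → Word m n → Set where
    delX   : ∀ (p s : Word m n) (x : Fin m) → Step (p ++ inj₁ x ∷ s) (p ++ s)
    insY   : ∀ (p s : Word m n) (y : Fin n) → Step (p ++ s) (p ++ inj₂ y ∷ s)
    transp : ∀ (p s : Word m n) (x : Fin m) (y : Fin n) →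
             Step (p ++ inj₁ x ∷ inj₂ y ∷ s) (p ++ inj₂ y ∷ inj₁ x ∷ s)

  BubStep : Word m n → Word m n → Set
  BubStep u v = IsShuf u × IsShuf v × Step u v

  _≤bub_ : Word m n → Word m n → Set
  u ≤bub v = Star BubStep u v

  record IsLinearExtension (L : Word m n → Word m n → Set) : Set where
    field
      refl′   : ∀ u → IsShuf u → L u u
      antisym : ∀ u v → IsShuf u → IsShuf v → L u v → L v u → u ≡ v
      trans′  : ∀ u v w → IsShuf u → IsShuf v → IsShuf w → L u v → L v w → L u w
      total   : ∀ u v → IsShuf u → IsShuf v → L u v ⊎ L v u
      extends : ∀ u v → IsShuf u → IsShuf v → u ≤bub v → L u v

  record Realizer (d : ℕ) : Set₁ where
    field
      ext       : Fin d → Word m n → Word m n → Set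
      isLinExt  : ∀ i → IsLinearExtension (ext i)
      intersect : ∀ u v → IsShuf u → IsShuf v → (u ≤bub v ⇔ (∀ i → ext i u v))

DimBubAtLeast : ℕ → ℕ → ℕ → Set₁
DimBubAtLeast m n k = ∀ (d : ℕ) → Realizer {m} {n} d → k Data.Nat.≤ d

module Submission where

-- For each of the m + n letters c we exhibit a pair a c, b c in Shuf(m,n) with
-- a c ≤bub b c′ exactly when c ≠ c′ (a standard example): for x_i take
-- a = X∖{x_i} and b = x_i y_1⋯y_n, for y_j take a = x_1⋯x_m y_j and b = Y∖{y_j}.
-- The comparabilities are realised by deleting X-letters and then inserting
-- Y-letters; the incomparabilities hold because along ≤bub an X-letter can only
-- disappear and a Y-letter only appear. Every realizer must reverse each pair
-- (a c , b c) in some extension, and distinct letters need distinct extensions.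

open import Defs
open import Data.Nat using (ℕ; zero; suc; _+_)
open import Data.Fin using (Fin; zero; suc) renaming (_<_ to _<ᶠ_)
open import Data.Fin.Properties using (<-irrefl; _≟_; injective⇒≤; +↔⊎)
open import Data.Sum using (_⊎_; inj₁; inj₂; [_,_]′)
open import Data.Sum.Properties using (≡-dec)
open import Data.Sum.Relation.Binary.LeftOrder using (_⊎-<_; ₁∼₂; ₁∼₁; ₂∼₂)
open import Data.Maybe using (Maybe; just; nothing)
open import Data.Product using (∃; _,_; proj₁; proj₂)
open import Data.Empty using (⊥-elim)
open import Data.List using (List; []; _∷_; _++_; [_]; map; mapMaybe; filter; allFin)
open import Data.List.Properties using (++-assoc)
open import Data.List.Membership.Propositional using (_∈_)
open import Data.List.Membership.Propositional.Properties
  using (∈-++⁺ˡ; ∈-++⁺ʳ; ∈-++⁻; ∈-map⁻; ∈-filter⁺; ∈-filter⁻; ∈-allFin)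
open import Data.List.Relation.Unary.All as All using (All; []; _∷_)
import Data.List.Relation.Unary.All.Properties as All
open import Data.List.Relation.Unary.Any using (here; there)
open import Data.List.Relation.Unary.AllPairs as AllPairs using (AllPairs; []; _∷_)
import Data.List.Relation.Unary.AllPairs.Properties as AllPairs
open import Data.List.Relation.Unary.Linked.Properties using (AllPairs⇒Linked)
open import Data.List.Relation.Binary.Sublist.Propositional
  using (_⊆_; []; _∷_; _∷ʳ_; ⊆-refl; from∈)
open import Data.List.Relation.Binary.Sublist.Propositional.Properties
  using (++⁺; map⁺; []⊆-universal; All-resp-⊆)
open import Data.List.Relation.Binary.Permutation.Propositional using (swap; ↭-refl)
open import Data.List.Relation.Binary.Permutation.Propositional.Properties
  using (∈-resp-↭; ++⁺ˡ)
open import Function using (_∘_; id; _↣_; Injection; mk↣; Equivalence)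
open import Function.Construct.Composition using (_↣-∘_)
open import Function.Properties.Inverse using (↔⇒↣)
open import Level using (0ℓ)
open import Relation.Binary.Core using (Rel)
open import Relation.Binary.Definitions using (DecidableEquality)
open import Relation.Binary.PropositionalEquality
  using (_≡_; _≢_; refl; sym; cong; subst; subst₂)
open import Relation.Binary.Construct.Closure.ReflexiveTransitive using (ε; _◅_; _◅◅_; fold)
open import Relation.Nullary using (¬_; ¬?; yes; no)

∀⊎⇒∀⊎∃ : ∀ {d} {P Q : Fin d → Set} → (∀ k → P k ⊎ Q k) → (∀ k → P k) ⊎ ∃ Q
∀⊎⇒∀⊎∃ {zero} _ = inj₁ λ ()
∀⊎⇒∀⊎∃ {suc d} h with h zero | ∀⊎⇒∀⊎∃ (h ∘ suc)
... | inj₂ q | _            = inj₂ (zero , q)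
... | inj₁ _ | inj₂ (k , q) = inj₂ (suc k , q)
... | inj₁ p | inj₁ ps      = inj₁ λ { zero → p ; (suc k) → ps k }

AllPairs-resp-⊆ : ∀ {A : Set} {R : Rel A 0ℓ} {xs ys} →
                  xs ⊆ ys → AllPairs R ys → AllPairs R xs
AllPairs-resp-⊆ []         []       = []
AllPairs-resp-⊆ (_ ∷ʳ τ)   (_ ∷ rs) = AllPairs-resp-⊆ τ rs
AllPairs-resp-⊆ (refl ∷ τ) (r ∷ rs) = All-resp-⊆ τ r ∷ AllPairs-resp-⊆ τ rs

module _ {A B : Set} {R : Rel A 0ℓ} {S : Rel B 0ℓ} (f : A → Maybe B)
         (f-mono : ∀ {x x′ y y′} → f x ≡ just y → f x′ ≡ just y′ → R x x′ → S y y′) where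

  All-mapMaybe⁺ : ∀ {x y xs} → f x ≡ just y → All (R x) xs → All (S y) (mapMaybe f xs)
  All-mapMaybe⁺ _ [] = []
  All-mapMaybe⁺ {xs = x′ ∷ _} fx (r ∷ rs) with f x′ in fx′
  ... | just _  = f-mono fx fx′ r ∷ All-mapMaybe⁺ fx rs
  ... | nothing = All-mapMaybe⁺ fx rs

  AllPairs-mapMaybe⁺ : ∀ {xs} → AllPairs R xs → AllPairs S (mapMaybe f xs)
  AllPairs-mapMaybe⁺ [] = []
  AllPairs-mapMaybe⁺ {x ∷ _} (r ∷ rs) with f x in fx
  ... | just _  = All-mapMaybe⁺ fx r ∷ AllPairs-mapMaybe⁺ rs
  ... | nothing = AllPairs-mapMaybe⁺ rs

module _ {A : Set} {c a : A} where

  ∈-insert⁺ : ∀ p {s} → c ∈ p ++ s → c ∈ p ++ a ∷ s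
  ∈-insert⁺ p = [ ∈-++⁺ˡ , ∈-++⁺ʳ p ∘ there ]′ ∘ ∈-++⁻ p

  ∈-delete⁺ : ∀ p {s} → c ∈ p ++ a ∷ s → c ≢ a → c ∈ p ++ s
  ∈-delete⁺ p h c≢a with ∈-++⁻ p h
  ... | inj₁ h′         = ∈-++⁺ˡ h′
  ... | inj₂ (here c≡a) = ⊥-elim (c≢a c≡a)
  ... | inj₂ (there h′) = ∈-++⁺ʳ p h′

  ∈-swap⁺ : ∀ {b} p {s} → c ∈ p ++ a ∷ b ∷ s → c ∈ p ++ b ∷ a ∷ s
  ∈-swap⁺ {b} p = ∈-resp-↭ (++⁺ˡ p (swap a b ↭-refl))

_except_ : ∀ k → Fin k → List (Fin k)
k except i = filter (λ j → ¬? (j ≟ i)) (allFin k)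

allFin-sorted : ∀ k → AllPairs _<ᶠ_ (allFin k)
allFin-sorted k = AllPairs.tabulate⁺-< id

except-sorted : ∀ {k} (i : Fin k) → AllPairs _<ᶠ_ (k except i)
except-sorted {k} i = AllPairs.filter⁺ (λ j → ¬? (j ≟ i)) (allFin-sorted k)

∉-except : ∀ {k} (i : Fin k) → ¬ i ∈ k except i
∉-except {k} i h = proj₂ (∈-filter⁻ (λ j → ¬? (j ≟ i)) {xs = allFin k} h) refl

∈-except : ∀ {k} {i j : Fin k} → j ≢ i → j ∈ k except i
∈-except {i = i} {j} j≢i = ∈-filter⁺ (λ j → ¬? (j ≟ i)) (∈-allFin j) j≢i

module _ {m n : ℕ} where

  record StandardExample (I : Set) : Set where
    field
      a b    : I → Word m n
      a-shuf : ∀ i → IsShuf (a i)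
      b-shuf : ∀ i → IsShuf (b i)
      a≤b    : ∀ {i j} → i ≢ j → a i ≤bub b j
      a≰b    : ∀ i → ¬ a i ≤bub b i

  -- Each b i lies below a i in some extension of a realizer; two indices using the
  -- same extension L give b i ≤ a i ≤ b j ≤ a j ≤ b i in L, forcing b i ≡ b j.
  standardExample↣realizer : ∀ {I d} → StandardExample I → DecidableEquality I →
                              Realizer {m} {n} d → I ↣ Fin d
  standardExample↣realizer S _≟ᴵ_ R = mk↣ reversal-injective
    where
    open StandardExample S
    open Realizer R
    open IsLinearExtension

    reversal : ∀ i → ∃ λ k → ext k (b i) (a i)
    reversal i with ∀⊎⇒∀⊎∃ (λ k → total (isLinExt k) _ _ (a-shuf i) (b-shuf i))
    ... | inj₁ a≤ᵏb = ⊥-elim (a≰b i (Equivalence.from (intersect _ _ (a-shuf i) (b-shuf i)) a≤ᵏb))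
    ... | inj₂ b≤ᵏa = b≤ᵏa

    reversal-injective : ∀ {i j} → proj₁ (reversal i) ≡ proj₁ (reversal j) → i ≡ j
    reversal-injective {i} {j} k≡k′ with i ≟ᴵ j
    ... | yes i≡j = i≡j
    ... | no  i≢j = ⊥-elim (a≰b i (subst (a i ≤bub_) (sym bi≡bj) (a≤b i≢j)))
      where
      k = proj₁ (reversal i)
      L = isLinExt k
      bi≤ai : ext k (b i) (a i)
      bi≤ai = proj₂ (reversal i)
      bj≤aj : ext k (b j) (a j)
      bj≤aj = subst (λ k′ → ext k′ (b j) (a j)) (sym k≡k′) (proj₂ (reversal j))
      b≤b : ∀ {i j} → i ≢ j → ext k (b i) (a i) → ext k (b i) (b j)
      b≤b {i} {j} i≢j bi≤ai =
        trans′ L _ _ _ (b-shuf i) (a-shuf i) (b-shuf j) bi≤ai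
          (extends L _ _ (a-shuf i) (b-shuf j) (a≤b i≢j))
      bi≡bj : b i ≡ b j
      bi≡bj = antisym L _ _ (b-shuf i) (b-shuf j)
                (b≤b i≢j bi≤ai) (b≤b (i≢j ∘ sym) bj≤aj)

  _≺_ : Rel (Letter m n) 0ℓ
  _≺_ = _<ᶠ_ ⊎-< _<ᶠ_

  Sorted : Word m n → Set
  Sorted = AllPairs _≺_

  ≺⇒≢ : ∀ {c c′} → c ≺ c′ → c ≢ c′
  ≺⇒≢ (₁∼₁ i<i) refl = <-irrefl refl i<i
  ≺⇒≢ (₂∼₂ j<j) refl = <-irrefl refl j<j

  getX-mono : ∀ {c c′ i i′} → getX c ≡ just i → getX c′ ≡ just i′ → c ≺ c′ → i <ᶠ i′
  getX-mono {inj₁ _} {inj₁ _} refl refl (₁∼₁ i<i′) = i<i′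

  getY-mono : ∀ {c c′ j j′} → getY c ≡ just j → getY c′ ≡ just j′ → c ≺ c′ → j <ᶠ j′
  getY-mono {inj₂ _} {inj₂ _} refl refl (₂∼₂ j<j′) = j<j′

  Sorted⇒IsShuf : ∀ {u} → Sorted u → IsShuf u
  Sorted⇒IsShuf s = AllPairs.map ≺⇒≢ s
                  , AllPairs⇒Linked (AllPairs-mapMaybe⁺ getX getX-mono s)
                  , AllPairs⇒Linked (AllPairs-mapMaybe⁺ getY getY-mono s)

  Step⇒≤bub : ∀ {u v} → Sorted u → Sorted v → Step u v → u ≤bub v
  Step⇒≤bub su sv st = (Sorted⇒IsShuf su , Sorted⇒IsShuf sv , st) ◅ ε

  block : List (Fin m) → List (Fin n) → Word m n
  block xs ys = map inj₁ xs ++ map inj₂ ys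

  block-sorted : ∀ {xs ys} → AllPairs _<ᶠ_ xs → AllPairs _<ᶠ_ ys → Sorted (block xs ys)
  block-sorted {xs} {ys} sx sy =
    AllPairs.++⁺ (AllPairs.map⁺ (AllPairs.map ₁∼₁ sx)) (AllPairs.map⁺ (AllPairs.map ₂∼₂ sy))
      (All.map⁺ (All.universal (λ _ → All.map⁺ (All.universal (λ _ → ₁∼₂) ys)) xs))

  -- Every intermediate word is a sublist of the sorted word at the far end,
  -- hence lies in Shuf(m,n).
  deletions : ∀ p t {xs xs′} → xs′ ⊆ xs → Sorted (p ++ map inj₁ xs ++ t) →
              (p ++ map inj₁ xs ++ t) ≤bub (p ++ map inj₁ xs′ ++ t)
  deletions p t [] _ = ε
  deletions p t (x ∷ʳ τ) s = Step⇒≤bub s s′ (delX p _ x) ◅◅ deletions p t τ s′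
    where s′ = AllPairs-resp-⊆ (++⁺ ⊆-refl (inj₁ x ∷ʳ ⊆-refl)) s
  deletions p t {x ∷ xs} (refl ∷ τ) s =
    subst₂ _≤bub_ (++-assoc p _ _) (++-assoc p _ _)
      (deletions (p ++ [ inj₁ x ]) t τ (subst Sorted (sym (++-assoc p _ _)) s))

  insertions : ∀ p {ys ys′} → ys ⊆ ys′ → Sorted (p ++ map inj₂ ys′) →
               (p ++ map inj₂ ys) ≤bub (p ++ map inj₂ ys′)
  insertions p [] _ = ε
  insertions p (y ∷ʳ σ) s = insertions p σ s′ ◅◅ Step⇒≤bub s′ s (insY p _ y)
    where s′ = AllPairs-resp-⊆ (++⁺ ⊆-refl (inj₂ y ∷ʳ ⊆-refl)) s
  insertions p {y ∷ _} (refl ∷ σ) s =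
    subst₂ _≤bub_ (++-assoc p _ _) (++-assoc p _ _)
      (insertions (p ++ [ inj₂ y ]) σ (subst Sorted (sym (++-assoc p _ _)) s))

  block≤block : ∀ {xs xs′ ys ys′} → xs′ ⊆ xs → ys ⊆ ys′ →
                AllPairs _<ᶠ_ xs → AllPairs _<ᶠ_ ys′ → block xs ys ≤bub block xs′ ys′
  block≤block {ys = ys} τ σ sx sy =
    deletions [] (map inj₂ ys) τ (AllPairs-resp-⊆ (++⁺ ⊆-refl (map⁺ inj₂ σ)) s)
    ◅◅ insertions (map inj₁ _) σ (AllPairs-resp-⊆ (++⁺ (map⁺ inj₁ τ) ⊆-refl) s)
    where s = block-sorted sx sy

  Step-reflects-∈X : ∀ {u v : Word m n} {i} → Step u v → inj₁ i ∈ v → inj₁ i ∈ u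
  Step-reflects-∈X (delX p _ _)     = ∈-insert⁺ p
  Step-reflects-∈X (insY p _ _)     = λ h → ∈-delete⁺ p h λ ()
  Step-reflects-∈X (transp p _ _ _) = ∈-swap⁺ p

  Step-preserves-∈Y : ∀ {u v : Word m n} {j} → Step u v → inj₂ j ∈ u → inj₂ j ∈ v
  Step-preserves-∈Y (delX p _ _)     = λ h → ∈-delete⁺ p h λ ()
  Step-preserves-∈Y (insY p _ _)     = ∈-insert⁺ p
  Step-preserves-∈Y (transp p _ _ _) = ∈-swap⁺ p

  ≤bub-reflects-∈X : ∀ {u v : Word m n} {i} → u ≤bub v → inj₁ i ∈ v → inj₁ i ∈ u
  ≤bub-reflects-∈X = fold (λ u v → _ ∈ v → _ ∈ u)
                          (λ (_ , _ , st) k → Step-reflects-∈X st ∘ k) id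

  ≤bub-preserves-∈Y : ∀ {u v : Word m n} {j} → u ≤bub v → inj₂ j ∈ u → inj₂ j ∈ v
  ≤bub-preserves-∈Y = fold (λ u v → _ ∈ u → _ ∈ v)
                           (λ (_ , _ , st) k → k ∘ Step-preserves-∈Y st) id

  inj₁∈block⁻ : ∀ {i xs ys} → inj₁ i ∈ block xs ys → i ∈ xs
  inj₁∈block⁻ {xs = xs} h with ∈-++⁻ (map inj₁ xs) h
  ... | inj₁ h′ with ∈-map⁻ inj₁ h′
  ...   | _ , i∈xs , refl = i∈xs
  inj₁∈block⁻ {xs = xs} h | inj₂ h′ with ∈-map⁻ inj₂ h′
  ...   | _ , _ , ()

  inj₂∈block⁻ : ∀ {j xs ys} → inj₂ j ∈ block xs ys → j ∈ ys
  inj₂∈block⁻ {xs = xs} h with ∈-++⁻ (map inj₁ xs) h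
  ... | inj₁ h′ with ∈-map⁻ inj₁ h′
  ...   | _ , _ , ()
  inj₂∈block⁻ {xs = xs} h | inj₂ h′ with ∈-map⁻ inj₂ h′
  ...   | _ , j∈ys , refl = j∈ys

  bubStandardExample : StandardExample (Fin m ⊎ Fin n)
  bubStandardExample = record
    { a = a ; b = b ; a-shuf = a-shuf ; b-shuf = b-shuf ; a≤b = a≤b ; a≰b = a≰b }
    where
    a b : Fin m ⊎ Fin n → Word m n
    a (inj₁ i) = block (m except i) []
    a (inj₂ j) = block (allFin m) [ j ]
    b (inj₁ i) = block [ i ] (allFin n)
    b (inj₂ j) = block [] (n except j)

    a-shuf : ∀ c → IsShuf (a c)
    a-shuf (inj₁ i) = Sorted⇒IsShuf (block-sorted (except-sorted i) [])
    a-shuf (inj₂ j) = Sorted⇒IsShuf (block-sorted (allFin-sorted m) ([] ∷ []))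

    b-shuf : ∀ c → IsShuf (b c)
    b-shuf (inj₁ i) = Sorted⇒IsShuf (block-sorted ([] ∷ []) (allFin-sorted n))
    b-shuf (inj₂ j) = Sorted⇒IsShuf (block-sorted [] (except-sorted j))

    a≤b : ∀ {c c′} → c ≢ c′ → a c ≤bub b c′
    a≤b {inj₁ i} {inj₁ i′} c≢c′ =
      block≤block (from∈ (∈-except (c≢c′ ∘ cong inj₁ ∘ sym))) ([]⊆-universal _)
                  (except-sorted i) (allFin-sorted n)
    a≤b {inj₁ i} {inj₂ j′} _ =
      block≤block ([]⊆-universal _) ([]⊆-universal _) (except-sorted i) (except-sorted j′)
    a≤b {inj₂ j} {inj₁ i′} _ =
      block≤block (from∈ (∈-allFin i′)) (from∈ (∈-allFin j))
                  (allFin-sorted m) (allFin-sorted n)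
    a≤b {inj₂ j} {inj₂ j′} c≢c′ =
      block≤block ([]⊆-universal _) (from∈ (∈-except (c≢c′ ∘ cong inj₂)))
                  (allFin-sorted m) (except-sorted j′)

    a≰b : ∀ c → ¬ a c ≤bub b c
    a≰b (inj₁ i) r = ∉-except i (inj₁∈block⁻ (≤bub-reflects-∈X r (here refl)))
    a≰b (inj₂ j) r = ∉-except j (inj₂∈block⁻ {xs = []}
                       (≤bub-preserves-∈Y r (∈-++⁺ʳ (map inj₁ (allFin m)) (here refl))))

corollary4p23 : (m n : ℕ) → DimBubAtLeast m n (m + n)
corollary4p23 m n d R =
  injective⇒≤ (Injection.injective (standardExample↣realizer bubStandardExample
                                      (≡-dec _≟_ _≟_) R ↣-∘ ↔⇒↣ +↔⊎))
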